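{- Let $C_n$ be the cycle of order $n\ge 3$, $G_1,G_2$ disjoint copies of $C_n$, and $f:V(G_1)\to V(G_2)$ a function with $|\mathrm{Range}(f)|=s$, where $1<s<n$. Then $3\le Z(C(C_n,f))\le s+2$. Moreover, both bounds are sharp: each bound is attained by $C(C_n,f)$ for some $n\ge 3$ and some function $f$ with $1<|\mathrm{Range}(f)|<n$.
   Context: Zero forcing: color each vertex of a graph $H$ black or white, with $S$ the initial set of black vertices. The color-change rule turns a white vertex $u_2$ black if $u_2$ is the only white neighbor of some black vertex $u_1$. $S$ is a zero forcing set of $H$ if all vertices become black after finitely many applications of the rule. $Z(H)$ is the minimum size of a zero forcing set of $H$. Functigraph: given disjoint copies $G_1,G_2$ of $G$ and $f:V(G_1)\to V(G_2)$, $C(G,f)$ has vertex set $V(G_1)\cup V(G_2)$ and edge set $E(G_1)\cup E(G_2)\cup\{uv \mid v=f(u)\}$. -}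

module Defs where

open import Data.Nat using (ℕ; zero; suc; _+_; _≤_; _<_)
open import Data.Fin using (Fin; toℕ; splitAt)
open import Data.Fin.Properties using (any?; _≟_)
open import Data.Fin.Subset using (Subset; _∈_; ∣_∣)
open import Data.Vec using (tabulate)
open import Data.Sum using (_⊎_; inj₁; inj₂)
open import Data.Product using (_×_; ∃-syntax)
open import Data.Empty using (⊥)
open import Relation.Binary.PropositionalEquality using (_≡_; _≢_)
open import Relation.Nullary.Decidable using (does)

Graph : ℕ → Set₁
Graph m = Fin m → Fin m → Set

CycleAdj : (n : ℕ) → Graph n
CycleAdj n i j =
  (toℕ i + 1 ≡ toℕ j) ⊎ (toℕ j + 1 ≡ toℕ i)
  ⊎ (toℕ i + 1 ≡ n × toℕ j ≡ 0) ⊎ (toℕ j + 1 ≡ n × toℕ i ≡ 0)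

-- Functigraph C(G,f) of a graph G on Fin n with f : V(G₁) → V(G₂).
-- Vertices Fin (n + n): the first n are G₁, the last n are G₂ (via splitAt).
Functigraph : {n : ℕ} → Graph n → (Fin n → Fin n) → Graph (n + n)
Functigraph {n} G f x y with splitAt n x | splitAt n y
... | inj₁ u | inj₁ v = G u v
... | inj₂ u | inj₂ v = G u v
... | inj₁ u | inj₂ v = v ≡ f u
... | inj₂ v | inj₁ u = v ≡ f u

range : {n : ℕ} → (Fin n → Fin n) → Subset n
range f = tabulate (λ v → does (any? (λ u → f u ≟ v)))

-- Vertices that eventually become black starting from black set S,
-- under the colour-change rule (closure of the forcing process).
data Black {m : ℕ} (H : Graph m) (S : Subset m) : Fin m → Set where
  initial : ∀ {v} → v ∈ S → Black H S v
  force   : ∀ {u w} → Black H S u → H u w →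
            (∀ x → H u x → x ≢ w → Black H S x) → Black H S w

IsZeroForcingSet : {m : ℕ} → Graph m → Subset m → Set
IsZeroForcingSet H S = ∀ v → Black H S v

_≤Z_ : {m : ℕ} → ℕ → Graph m → Set
k ≤Z H = ∀ S → IsZeroForcingSet H S → k ≤ ∣ S ∣

_Z≤_ : {m : ℕ} → Graph m → ℕ → Set
H Z≤ k = ∃[ S ] (IsZeroForcingSet H S × ∣ S ∣ ≤ k)

_Z≡_ : {m : ℕ} → Graph m → ℕ → Set
H Z≡ k = (k ≤Z H) × (H Z≤ k)

module Submission where

-- In C(C_n, f) every vertex has degree 3, except the vertices ι₂ c of the second cycle with
-- c ∉ Range(f), which have degree 2.  So a set S with |S| ≤ 2 can only start forcing at such a
-- ι₂ c whose cycle neighbour is also in S.  Forcing then runs along the range-free arc through c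
-- and stops at its ends a, b ∈ Range(f), each of which still has two white neighbours --
-- unless the arc wraps around, in which case Range(f) ⊆ {a, b} and the process stops
-- after blackening the first-cycle vertices with a singleton fibre, no two of them adjacent.
-- Each stopping set is closed under the colour-change rule, whence Z ≥ 3.
-- For Z ≤ s + 2 take c ∉ Range(f) with prev c ∈ Range(f) and the first b ∈ Range(f) after c, and
-- seed two adjacent first-cycle vertices, c, and Range(f) ∖ {b}: the arc c … b is forced, then
-- the first cycle around (each vertex sees its image black), then the second cycle.

open import Defs
open import Data.Bool using (_∨_)
open import Data.Empty using (⊥; ⊥-elim)
open import Data.Fin using (Fin; zero; suc; toℕ; fromℕ; fromℕ<; inject₁; splitAt; join; _↑ˡ_; _↑ʳ_)
open import Data.Fin.Properties
  using (any?; all?; ¬∀⟶∃¬; _≟_; toℕ-injective; toℕ<n; toℕ-fromℕ; toℕ-fromℕ<; toℕ-inject₁;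
         splitAt-↑ˡ; splitAt-↑ʳ; join-splitAt)
open import Data.Fin.Subset using (Subset; _∈_; _∉_; _⊆_; ∣_∣; _∪_; _-_; ⁅_⁆; ⊤; inside; outside)
  renaming (⊥ to ∅)
open import Data.Fin.Subset.Properties
  using (_∈?_; _⊆?_; anySubset?; ∈⊤; x∈p⇒∣p-x∣<∣p∣; x∈p∧x∉q⇒x∈p─q; x∈⁅x⁆; x∈⁅y⁆⇒x≡y; drop-there;
         p⊆q⇒∣p∣≤∣q∣; ∣⁅x⁆∣≡1; ∣⊥∣≡0; p⊆p∪q; q⊆p∪q)
open import Data.Nat using (ℕ; zero; suc; _+_; _∸_; _≤_; _<_; z≤n; s≤s; _<?_; _≤?_)
open import Data.Nat.GeneralisedArithmetic using (iterate)
open import Data.Nat.Properties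
  using (≤-refl; ≤-trans; ≤-antisym; ≤-reflexive; ≤-pred; <-irrefl; <⇒≤; <⇒≱; ≮⇒≥; ≰⇒>; n≤1+n; n<1+n;
         m≤n⇒m≤1+n; m≤n⇒m<n∨m≡n; +-comm; +-suc; +-monoʳ-≤; m∸n+n≡m; suc-injective; 1+n≢n; m≢1+n+m;
         anyUpTo?; module ≤-Reasoning)
import Data.Nat.Properties as ℕ
open import Data.Product using (_×_; _,_; proj₁; proj₂; ∃-syntax)
open import Data.Sum using (_⊎_; inj₁; inj₂; [_,_]; [_,_]′)
open import Data.Vec using ([]; _∷_; _++_; here; there; tabulate)
open import Data.Vec.Properties using (lookup∘tabulate; []=⇒lookup; lookup⇒[]=; lookup-++ˡ; lookup-++ʳ)
open import Function using (id; _∘_; case_of_)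
open import Relation.Nullary using (¬_; Dec; yes; no; does; contradiction)
open import Relation.Nullary.Decidable
  using (False; toWitnessFalse; map′; ¬?; _→-dec_; _×-dec_; _⊎-dec_; dec-true; dec-false; decidable-stable)
open import Relation.Binary.PropositionalEquality
  using (_≡_; _≢_; refl; sym; trans; cong; subst; module ≡-Reasoning)

module _ {m : ℕ} (H : Graph m) where

  ForcingClosed : (Fin m → Set) → Set
  ForcingClosed P = ∀ {u v} → P u → H u v → ¬ P v → ∃[ x ] (H u x × x ≢ v × ¬ P x)

  Black⇒closed : ∀ {S P} → (∀ v → Dec (P v)) → (∀ {v} → v ∈ S → P v) → ForcingClosed P →
                 ∀ {v} → Black H S v → P v
  Black⇒closed P? S⊆P closed (initial v∈S) = S⊆P v∈S
  Black⇒closed P? S⊆P closed {w} (force black-u u~w rest) with P? w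
  ... | yes Pw = Pw
  ... | no ¬Pw with closed (Black⇒closed P? S⊆P closed black-u) u~w ¬Pw
  ...   | x , u~x , x≢w , ¬Px = ⊥-elim (¬Px (Black⇒closed P? S⊆P closed (rest x u~x x≢w)))

  closed⇒¬zeroForcing : ∀ {S P v} → (∀ v → Dec (P v)) → (∀ {v} → v ∈ S → P v) →
                        ForcingClosed P → ¬ P v → ¬ IsZeroForcingSet H S
  closed⇒¬zeroForcing P? S⊆P closed ¬Pv zfs = ¬Pv (Black⇒closed P? S⊆P closed (zfs _))

module Search {m} {H : Graph m} (H? : ∀ u v → Dec (H u v)) where

  closed? : ∀ P → Dec (ForcingClosed H (_∈ P))
  closed? P = map′ (λ closed {u} {v} → closed u v) (λ closed u v → closed)
    (all? λ u → all? λ v → u ∈? P →-dec H? u v →-dec ¬? (v ∈? P) →-dec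
      any? λ x → H? u x ×-dec ¬? (x ≟ v) ×-dec ¬? (x ∈? P))

  forceOnce : Subset m → Subset m
  forceOnce P = tabulate λ v → does (v ∈? P) ∨ does (any? λ u → u ∈? P ×-dec H? u v ×-dec
    all? λ x → H? u x →-dec ¬? (x ≟ v) →-dec x ∈? P)

  derived : Subset m → Subset m
  derived S = iterate forceOnce S m

  -- Soundness uses only the three checked properties; the m rounds of forcing merely make
  -- derived S the whole derived set, so that the check succeeds whenever S is not zero forcing.
  Stalls : Subset m → Set
  Stalls S = ForcingClosed H (_∈ derived S) × S ⊆ derived S × ∃[ x ] x ∉ derived S

  stalls? : ∀ S → Dec (Stalls S)
  stalls? S = closed? (derived S) ×-dec S ⊆? derived S ×-dec any? (λ x → ¬? (x ∈? derived S))

  stalls⇒¬zeroForcing : ∀ {S} → Stalls S → ¬ IsZeroForcingSet H S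
  stalls⇒¬zeroForcing {S} (closed , S⊆P , _ , x∉P) = closed⇒¬zeroForcing H (_∈? derived S) S⊆P closed x∉P

  ≤Z-by-search : ∀ z → False (anySubset? λ S → ¬? (z ≤? ∣ S ∣ ⊎-dec stalls? S)) → z ≤Z H
  ≤Z-by-search z no-counterexample S zfs with z ≤? ∣ S ∣ | stalls? S
  ... | yes z≤∣S∣ | _ = z≤∣S∣
  ... | no _ | yes stalls = ⊥-elim (stalls⇒¬zeroForcing stalls zfs)
  ... | no z≰∣S∣ | no ¬stalls = ⊥-elim (toWitnessFalse no-counterexample (S , [ z≰∣S∣ , ¬stalls ]))

∣p∪q∣≤∣p∣+∣q∣ : ∀ {n} (p q : Subset n) → ∣ p ∪ q ∣ ≤ ∣ p ∣ + ∣ q ∣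
∣p∪q∣≤∣p∣+∣q∣ [] [] = z≤n
∣p∪q∣≤∣p∣+∣q∣ (inside ∷ p) (inside ∷ q) =
  s≤s (≤-trans (m≤n⇒m≤1+n (∣p∪q∣≤∣p∣+∣q∣ p q)) (≤-reflexive (sym (+-suc ∣ p ∣ ∣ q ∣))))
∣p∪q∣≤∣p∣+∣q∣ (inside ∷ p) (outside ∷ q) = s≤s (∣p∪q∣≤∣p∣+∣q∣ p q)
∣p∪q∣≤∣p∣+∣q∣ (outside ∷ p) (inside ∷ q) =
  ≤-trans (s≤s (∣p∪q∣≤∣p∣+∣q∣ p q)) (≤-reflexive (sym (+-suc ∣ p ∣ ∣ q ∣)))
∣p∪q∣≤∣p∣+∣q∣ (outside ∷ p) (outside ∷ q) = ∣p∪q∣≤∣p∣+∣q∣ p q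

∣p++q∣≡∣p∣+∣q∣ : ∀ {a b} (p : Subset a) (q : Subset b) → ∣ p ++ q ∣ ≡ ∣ p ∣ + ∣ q ∣
∣p++q∣≡∣p∣+∣q∣ [] q = refl
∣p++q∣≡∣p∣+∣q∣ (inside ∷ p) q = cong suc (∣p++q∣≡∣p∣+∣q∣ p q)
∣p++q∣≡∣p∣+∣q∣ (outside ∷ p) q = ∣p++q∣≡∣p∣+∣q∣ p q

module _ {a b} {p : Subset a} {q : Subset b} where

  x∈p⇒x↑ˡ∈p++q : ∀ {x} → x ∈ p → x ↑ˡ b ∈ p ++ q
  x∈p⇒x↑ˡ∈p++q {x} x∈p = lookup⇒[]= _ (p ++ q) (trans (lookup-++ˡ p q x) ([]=⇒lookup x∈p))

  x∈q⇒a↑ʳx∈p++q : ∀ {x} → x ∈ q → a ↑ʳ x ∈ p ++ q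
  x∈q⇒a↑ʳx∈p++q {x} x∈q = lookup⇒[]= _ (p ++ q) (trans (lookup-++ʳ p q x) ([]=⇒lookup x∈q))

x,y,z∈p⇒3≤∣p∣ : ∀ {n} {p : Subset n} {x y z} → x ∈ p → y ∈ p → z ∈ p →
                x ≢ y → x ≢ z → y ≢ z → 3 ≤ ∣ p ∣
x,y,z∈p⇒3≤∣p∣ {p = p} {x} {y} {z} x∈p y∈p z∈p x≢y x≢z y≢z =
  ≤-trans (s≤s (≤-trans (s≤s (≤-trans (s≤s z≤n) (x∈p⇒∣p-x∣<∣p∣ z∈p-x-y)))
                        (x∈p⇒∣p-x∣<∣p∣ y∈p-x)))
          (x∈p⇒∣p-x∣<∣p∣ x∈p)
  where
  y∈p-x = x∈p∧x∉q⇒x∈p─q y∈p (λ y∈⁅x⁆ → x≢y (sym (x∈⁅y⁆⇒x≡y x y∈⁅x⁆)))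
  z∈p-x = x∈p∧x∉q⇒x∈p─q z∈p (λ z∈⁅x⁆ → x≢z (sym (x∈⁅y⁆⇒x≡y x z∈⁅x⁆)))
  z∈p-x-y = x∈p∧x∉q⇒x∈p─q z∈p-x (λ z∈⁅y⁆ → y≢z (sym (x∈⁅y⁆⇒x≡y y z∈⁅y⁆)))

∣p∣<n⇒∃∉ : ∀ {n} (p : Subset n) → ∣ p ∣ < n → ∃[ x ] x ∉ p
∣p∣<n⇒∃∉ (outside ∷ p) _ = zero , λ ()
∣p∣<n⇒∃∉ (inside ∷ p) (s≤s ∣p∣<n) with ∣p∣<n⇒∃∉ p ∣p∣<n
... | x , x∉p = suc x , x∉p ∘ drop-there

⊆⁅x⁆⇒∣p∣≤1 : ∀ {n} {p : Subset n} {x} → (∀ {y} → y ∈ p → y ≡ x) → ∣ p ∣ ≤ 1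
⊆⁅x⁆⇒∣p∣≤1 {x = x} only-x =
  subst (_ ≤_) (∣⁅x⁆∣≡1 x) (p⊆q⇒∣p∣≤∣q∣ (λ y∈p → subst (_∈ ⁅ x ⁆) (sym (only-x y∈p)) (x∈⁅x⁆ x)))

∣p∣≤2⇒¬x,y,z∈p : ∀ {n} {p : Subset n} → ∣ p ∣ ≤ 2 → ∀ {x y z} → x ∈ p → y ∈ p → z ∈ p →
                  x ≢ y → x ≢ z → y ≢ z → ⊥
∣p∣≤2⇒¬x,y,z∈p ∣p∣≤2 x∈p y∈p z∈p x≢y x≢z y≢z = <⇒≱ (s≤s ∣p∣≤2) (x,y,z∈p⇒3≤∣p∣ x∈p y∈p z∈p x≢y x≢z y≢z)

record ThreeNeighbours {m} (H : Graph m) (u : Fin m) : Set where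
  field
    {x y z} : Fin m
    u~x : H u x
    u~y : H u y
    u~z : H u z
    u≢x : u ≢ x
    u≢y : u ≢ y
    u≢z : u ≢ z
    x≢y : x ≢ y
    x≢z : x ≢ z
    y≢z : y ≢ z

module _ {m} {H : Graph m} {S : Subset m} (∣S∣≤2 : ∣ S ∣ ≤ 2) where

  three-neighbours⇒white-neighbour : ∀ {u} → u ∈ S → ThreeNeighbours H u →
                                     ∀ w → ∃[ v ] (H u v × v ≢ w × v ∉ S)
  three-neighbours⇒white-neighbour {u} u∈S nbrs w = choose (x ∈? S) (y ∈? S) (z ∈? S)
    where
    open ThreeNeighbours nbrs

    one-of : ∀ {a b} → H u a → H u b → a ≢ b → a ∉ S → b ∉ S → ∃[ v ] (H u v × v ≢ w × v ∉ S)
    one-of {a} u~a u~b a≢b a∉S b∉S with a ≟ w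
    ... | yes refl = _ , u~b , a≢b ∘ sym , b∉S
    ... | no a≢w = _ , u~a , a≢w , a∉S

    choose : Dec (x ∈ S) → Dec (y ∈ S) → Dec (z ∈ S) → ∃[ v ] (H u v × v ≢ w × v ∉ S)
    choose (yes x∈S) (yes y∈S) _         = ⊥-elim (∣p∣≤2⇒¬x,y,z∈p ∣S∣≤2 u∈S x∈S y∈S u≢x u≢y x≢y)
    choose (yes x∈S) (no _)    (yes z∈S) = ⊥-elim (∣p∣≤2⇒¬x,y,z∈p ∣S∣≤2 u∈S x∈S z∈S u≢x u≢z x≢z)
    choose (no _)    (yes y∈S) (yes z∈S) = ⊥-elim (∣p∣≤2⇒¬x,y,z∈p ∣S∣≤2 u∈S y∈S z∈S u≢y u≢z y≢z)
    choose (yes _)   (no y∉S)  (no z∉S)  = one-of u~y u~z y≢z y∉S z∉S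
    choose (no x∉S)  (yes _)   (no z∉S)  = one-of u~x u~z x≢z x∉S z∉S
    choose (no x∉S)  (no y∉S)  _         = one-of u~x u~y x≢y x∉S y∉S

two-valued : ∀ {A : Set} {a b x y z : A} → x ≡ a ⊎ x ≡ b → y ≡ a ⊎ y ≡ b → z ≡ a ⊎ z ≡ b →
             x ≢ y → z ≡ x ⊎ z ≡ y
two-valued (inj₁ refl) _           (inj₁ refl) _   = inj₁ refl
two-valued (inj₂ refl) _           (inj₂ refl) _   = inj₁ refl
two-valued (inj₁ refl) (inj₂ refl) (inj₂ refl) _   = inj₂ refl
two-valued (inj₂ refl) (inj₁ refl) (inj₁ refl) _   = inj₂ refl
two-valued (inj₁ refl) (inj₁ refl) (inj₂ refl) x≢y = contradiction refl x≢y
two-valued (inj₂ refl) (inj₂ refl) (inj₁ refl) x≢y = contradiction refl x≢y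

module _ {n} (f : Fin n → Fin n) where

  ∈-range⁺ : ∀ u {v} → f u ≡ v → v ∈ range f
  ∈-range⁺ u {v} fu≡v =
    lookup⇒[]= v (range f) (trans (lookup∘tabulate _ v) (dec-true (any? (λ u → f u ≟ v)) (u , fu≡v)))

  ∈-range⁻ : ∀ {v} → v ∈ range f → ∃[ u ] f u ≡ v
  ∈-range⁻ {v} v∈range = decidable-stable preimage? λ ∄u →
    contradiction (trans (sym ([]=⇒lookup v∈range)) (trans (lookup∘tabulate _ v) (dec-false preimage? ∄u))) λ ()
    where preimage? = any? (λ u → f u ≟ v)

least-witness : (P : ℕ → Set) → (∀ i → Dec (P i)) → ∀ {k} → P k →
                ∃[ j ] (P j × (∀ {i} → i < j → ¬ P i))
least-witness P P? {zero} P0 = zero , P0 , λ ()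
least-witness P P? {suc k} Pk with P? zero
... | yes P0 = zero , P0 , λ ()
... | no ¬P0 with least-witness (λ i → P (suc i)) (λ i → P? (suc i)) Pk
...   | j , Pj , below = suc j , Pj , λ { {zero} _ → ¬P0 ; {suc i} (s≤s i<j) → below i<j }

module Cycle (k : ℕ) where

  open ≡-Reasoning

  n : ℕ
  n = 3 + k

  next : Fin n → Fin n
  next i with suc (toℕ i) <? n
  ... | yes i+1<n = fromℕ< i+1<n
  ... | no _ = zero

  prev : Fin n → Fin n
  prev zero = fromℕ (2 + k)
  prev (suc j) = inject₁ j

  next-cases : ∀ i → (toℕ (next i) ≡ suc (toℕ i)) ⊎ (next i ≡ zero × suc (toℕ i) ≡ n)
  next-cases i with suc (toℕ i) <? n
  ... | yes i+1<n = inj₁ (toℕ-fromℕ< i+1<n)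
  ... | no i+1≮n = inj₂ (refl , ≤-antisym (toℕ<n i) (≮⇒≥ i+1≮n))

  toℕ-next : ∀ {i} → suc (toℕ i) < n → toℕ (next i) ≡ suc (toℕ i)
  toℕ-next {i} i+1<n with suc (toℕ i) <? n
  ... | yes i+1<n′ = toℕ-fromℕ< i+1<n′
  ... | no i+1≮n = contradiction i+1<n i+1≮n

  next-last : ∀ {i} → suc (toℕ i) ≡ n → next i ≡ zero
  next-last {i} i+1≡n with suc (toℕ i) <? n
  ... | yes i+1<n = contradiction i+1<n (<-irrefl i+1≡n)
  ... | no _ = refl

  next-unique : ∀ {i j} → toℕ i + 1 ≡ toℕ j ⊎ (toℕ i + 1 ≡ n × toℕ j ≡ 0) → next i ≡ j
  next-unique {i} {j} (inj₁ i+1≡j) =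
    toℕ-injective (trans (toℕ-next (subst (_< n) j≡ (toℕ<n j))) (sym j≡))
    where j≡ = trans (sym i+1≡j) (+-comm (toℕ i) 1)
  next-unique {i} {j} (inj₂ (i+1≡n , j≡0)) =
    trans (next-last (trans (+-comm 1 (toℕ i)) i+1≡n)) (toℕ-injective (sym j≡0))

  adj-next : ∀ i → CycleAdj n i (next i)
  adj-next i with next-cases i
  ... | inj₁ t = inj₁ (trans (+-comm (toℕ i) 1) (sym t))
  ... | inj₂ (z , i+1≡n) = inj₂ (inj₂ (inj₁ (trans (+-comm (toℕ i) 1) i+1≡n , cong toℕ z)))

  next-prev : ∀ i → next (prev i) ≡ i
  next-prev zero = next-last (cong suc (toℕ-fromℕ (2 + k)))
  next-prev (suc j) = next-unique (inj₁ (trans (+-comm _ 1) (cong suc (toℕ-inject₁ j))))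

  prev-next : ∀ i → prev (next i) ≡ i
  prev-next i with suc (toℕ i) <? n
  ... | yes (s≤s i+1≤n-1) = toℕ-injective (trans (toℕ-inject₁ (fromℕ< i+1≤n-1)) (toℕ-fromℕ< i+1≤n-1))
  ... | no i+1≮n =
        toℕ-injective (trans (toℕ-fromℕ (2 + k)) (suc-injective (≤-antisym (≮⇒≥ i+1≮n) (toℕ<n i))))

  next-injective : ∀ {i j} → next i ≡ next j → i ≡ j
  next-injective {i} {j} eq = trans (sym (prev-next i)) (trans (cong prev eq) (prev-next j))

  adj-sym : ∀ {i j} → CycleAdj n i j → CycleAdj n j i
  adj-sym (inj₁ x) = inj₂ (inj₁ x)
  adj-sym (inj₂ (inj₁ x)) = inj₁ x
  adj-sym (inj₂ (inj₂ (inj₁ x))) = inj₂ (inj₂ (inj₂ x))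
  adj-sym (inj₂ (inj₂ (inj₂ x))) = inj₂ (inj₂ (inj₁ x))

  adj-prev : ∀ i → CycleAdj n i (prev i)
  adj-prev i = adj-sym (subst (CycleAdj n (prev i)) (next-prev i) (adj-next (prev i)))

  adj⇒next⊎prev : ∀ {i j} → CycleAdj n i j → j ≡ next i ⊎ j ≡ prev i
  adj⇒next⊎prev (inj₁ i+1≡j) = inj₁ (sym (next-unique (inj₁ i+1≡j)))
  adj⇒next⊎prev (inj₂ (inj₂ (inj₁ wrap))) = inj₁ (sym (next-unique (inj₂ wrap)))
  adj⇒next⊎prev {i} {j} (inj₂ (inj₁ j+1≡i)) =
    inj₂ (trans (sym (prev-next j)) (cong prev (next-unique (inj₁ j+1≡i))))
  adj⇒next⊎prev {i} {j} (inj₂ (inj₂ (inj₂ wrap))) =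
    inj₂ (trans (sym (prev-next j)) (cong prev (next-unique (inj₂ wrap))))

  next≢id : ∀ i → next i ≢ i
  next≢id i next-i≡i with next-cases i
  ... | inj₁ t = 1+n≢n (trans (sym t) (cong toℕ next-i≡i))
  ... | inj₂ (z , i+1≡n) with trans (sym next-i≡i) z
  ...   | refl = case i+1≡n of λ ()

  next²≢id : ∀ i → next (next i) ≢ i
  next²≢id i eq with next-cases i | next-cases (next i)
  ... | inj₁ t | inj₁ t′ =
        m≢1+n+m (toℕ i) {1} (sym (trans (trans (sym (cong suc t)) (sym t′)) (cong toℕ eq)))
  ... | inj₁ t | inj₂ (z , i+2≡n) with trans (sym eq) z
  ...   | refl = case trans (sym (cong suc t)) i+2≡n of λ ()
  next²≢id i eq | inj₂ (z , i+1≡n) | _ with trans (sym (cong next z)) eq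
  ...   | refl = case i+1≡n of λ ()

  prev≢next : ∀ i → prev i ≢ next i
  prev≢next i eq = next²≢id i (trans (cong next (sym eq)) (next-prev i))

  prev≢id : ∀ i → prev i ≢ i
  prev≢id i eq = next≢id i (trans (cong next (sym eq)) (next-prev i))

  next^ : ℕ → Fin n → Fin n
  next^ zero i = i
  next^ (suc j) i = next (next^ j i)

  prev^ : ℕ → Fin n → Fin n
  prev^ zero i = i
  prev^ (suc j) i = prev (prev^ j i)

  next^-+ : ∀ a b i → next^ (a + b) i ≡ next^ a (next^ b i)
  next^-+ zero b i = refl
  next^-+ (suc a) b i = cong next (next^-+ a b i)

  next^-next : ∀ j i → next^ j (next i) ≡ next (next^ j i)
  next^-next zero i = refl
  next^-next (suc j) i = cong next (next^-next j i)

  next^-injective : ∀ j {x y} → next^ j x ≡ next^ j y → x ≡ y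
  next^-injective zero eq = eq
  next^-injective (suc j) eq = next^-injective j (next-injective eq)

  next^-prev^ : ∀ j i → next^ j (prev^ j i) ≡ i
  next^-prev^ zero i = refl
  next^-prev^ (suc j) i = begin
    next (next^ j (prev (prev^ j i)))  ≡⟨ sym (next^-next j _) ⟩
    next^ j (next (prev (prev^ j i)))  ≡⟨ cong (next^ j) (next-prev _) ⟩
    next^ j (prev^ j i)                ≡⟨ next^-prev^ j i ⟩
    i                                  ∎

  toℕ-next^-zero : ∀ {j} → j < n → toℕ (next^ j zero) ≡ j
  toℕ-next^-zero {zero} _ = refl
  toℕ-next^-zero {suc j} j+1<n =
    trans (toℕ-next (subst (λ t → suc t < n) (sym IH) j+1<n)) (cong suc IH)
    where IH = toℕ-next^-zero (≤-trans (n≤1+n _) j+1<n)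

  next^-toℕ : ∀ w → next^ (toℕ w) zero ≡ w
  next^-toℕ w = toℕ-injective (toℕ-next^-zero (toℕ<n w))

  next^-n : next^ n zero ≡ zero
  next^-n = next-last (cong suc (toℕ-next^-zero ≤-refl))

  next^-reaches-zero : ∀ c → next^ (n ∸ toℕ c) c ≡ zero
  next^-reaches-zero c = begin
    next^ (n ∸ toℕ c) c                         ≡⟨ cong (next^ (n ∸ toℕ c)) (sym (next^-toℕ c)) ⟩
    next^ (n ∸ toℕ c) (next^ (toℕ c) zero)      ≡⟨ sym (next^-+ (n ∸ toℕ c) (toℕ c) zero) ⟩
    next^ (n ∸ toℕ c + toℕ c) zero              ≡⟨ cong (λ l → next^ l zero) (m∸n+n≡m (<⇒≤ (toℕ<n c))) ⟩
    next^ n zero                                ≡⟨ next^-n ⟩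
    zero                                        ∎

  next^-surjective : ∀ c w → ∃[ j ] next^ j c ≡ w
  next^-surjective c w = toℕ w + (n ∸ toℕ c) , (begin
    next^ (toℕ w + (n ∸ toℕ c)) c        ≡⟨ next^-+ (toℕ w) (n ∸ toℕ c) c ⟩
    next^ (toℕ w) (next^ (n ∸ toℕ c) c)  ≡⟨ cong (next^ (toℕ w)) (next^-reaches-zero c) ⟩
    next^ (toℕ w) zero                   ≡⟨ next^-toℕ w ⟩
    w                                    ∎)

  prev^-surjective : ∀ c w → ∃[ j ] prev^ j c ≡ w
  prev^-surjective c w with next^-surjective w c
  ... | j , wj≡c = j , next^-injective j (trans (next^-prev^ j c) (sym wj≡c))

  next-closed⇒all : ∀ {P : Fin n → Set} {c} → P c → (∀ {x} → P x → P (next x)) → ∀ w → P w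
  next-closed⇒all {P} {c} Pc step w with next^-surjective c w
  ... | j , refl = iter j
    where
    iter : ∀ j → P (next^ j c)
    iter zero = Pc
    iter (suc j) = step (iter j)

  next-closed₂⇒all : ∀ {P : Fin n → Set} {c} → P (prev c) → P c →
                     (∀ {x} → P (prev x) → P x → P (next x)) → ∀ w → P w
  next-closed₂⇒all {P} P-prev-c P-c step =
    proj₂ ∘ next-closed⇒all {P = λ x → P (prev x) × P x} (P-prev-c , P-c)
      λ (P-prev-x , P-x) → subst P (sym (prev-next _)) P-x , step P-prev-x P-x

  prev-closed⇒all : ∀ {P : Fin n → Set} {c} → P c → (∀ {x} → P x → P (prev x)) → ∀ w → P w
  prev-closed⇒all {P} {c} Pc step w with prev^-surjective c w
  ... | j , refl = iter j
    where
    iter : ∀ j → P (prev^ j c)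
    iter zero = Pc
    iter (suc j) = step (iter j)

  next^-period⇒covered : ∀ {c l} → next (next^ l c) ≡ c → ∀ w → ∃[ i ] (i ≤ l × next^ i c ≡ w)
  next^-period⇒covered {c} {l} period = next-closed⇒all (zero , z≤n , refl) step
    where
    step : ∀ {x} → ∃[ i ] (i ≤ l × next^ i c ≡ x) → ∃[ i ] (i ≤ l × next^ i c ≡ next x)
    step (i , i≤l , refl) with m≤n⇒m<n∨m≡n i≤l
    ... | inj₁ i<l = suc i , i<l , refl
    ... | inj₂ refl = zero , z≤n , sym period

module CycleFunctigraph (k : ℕ) (f : Fin (3 + k) → Fin (3 + k)) where

  open Cycle k public

  H : Graph (n + n)
  H = Functigraph (CycleAdj n) f

  ι₁ ι₂ : Fin n → Fin (n + n)
  ι₁ u = u ↑ˡ n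
  ι₂ w = n ↑ʳ w

  ι-cases : ∀ x → (∃[ u ] x ≡ ι₁ u) ⊎ (∃[ w ] x ≡ ι₂ w)
  ι-cases x with splitAt n x in eq
  ... | inj₁ u = inj₁ (u , trans (sym (join-splitAt n n x)) (cong (join n n) eq))
  ... | inj₂ w = inj₂ (w , trans (sym (join-splitAt n n x)) (cong (join n n) eq))

  ι₁≢ι₂ : ∀ {u w} → ι₁ u ≢ ι₂ w
  ι₁≢ι₂ {u} {w} eq with trans (sym (splitAt-↑ˡ n u n)) (trans (cong (splitAt n) eq) (splitAt-↑ʳ n n w))
  ... | ()

  ι₁-injective : ∀ {u v} → ι₁ u ≡ ι₁ v → u ≡ v
  ι₁-injective {u} {v} eq with trans (sym (splitAt-↑ˡ n u n)) (trans (cong (splitAt n) eq) (splitAt-↑ˡ n v n))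
  ... | refl = refl

  ι₂-injective : ∀ {u v} → ι₂ u ≡ ι₂ v → u ≡ v
  ι₂-injective {u} {v} eq with trans (sym (splitAt-↑ʳ n n u)) (trans (cong (splitAt n) eq) (splitAt-↑ʳ n n v))
  ... | refl = refl

  H-ι₁ι₁ : ∀ u v → H (ι₁ u) (ι₁ v) ≡ CycleAdj n u v
  H-ι₁ι₁ u v rewrite splitAt-↑ˡ n u n | splitAt-↑ˡ n v n = refl

  H-ι₂ι₂ : ∀ u v → H (ι₂ u) (ι₂ v) ≡ CycleAdj n u v
  H-ι₂ι₂ u v rewrite splitAt-↑ʳ n n u | splitAt-↑ʳ n n v = refl

  H-ι₁ι₂ : ∀ u w → H (ι₁ u) (ι₂ w) ≡ (w ≡ f u)
  H-ι₁ι₂ u w rewrite splitAt-↑ˡ n u n | splitAt-↑ʳ n n w = refl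

  H-ι₂ι₁ : ∀ u w → H (ι₂ w) (ι₁ u) ≡ (w ≡ f u)
  H-ι₂ι₁ u w rewrite splitAt-↑ˡ n u n | splitAt-↑ʳ n n w = refl

  ι₁-next : ∀ u → H (ι₁ u) (ι₁ (next u))
  ι₁-next u = subst id (sym (H-ι₁ι₁ u (next u))) (adj-next u)

  ι₁-prev : ∀ u → H (ι₁ u) (ι₁ (prev u))
  ι₁-prev u = subst id (sym (H-ι₁ι₁ u (prev u))) (adj-prev u)

  ι₁-f : ∀ u → H (ι₁ u) (ι₂ (f u))
  ι₁-f u = subst id (sym (H-ι₁ι₂ u (f u))) refl

  ι₂-next : ∀ w → H (ι₂ w) (ι₂ (next w))
  ι₂-next w = subst id (sym (H-ι₂ι₂ w (next w))) (adj-next w)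

  ι₂-prev : ∀ w → H (ι₂ w) (ι₂ (prev w))
  ι₂-prev w = subst id (sym (H-ι₂ι₂ w (prev w))) (adj-prev w)

  ι₂-f⁻¹ : ∀ {u w} → f u ≡ w → H (ι₂ w) (ι₁ u)
  ι₂-f⁻¹ {u} {w} fu≡w = subst id (sym (H-ι₂ι₁ u w)) (sym fu≡w)

  ι₁-neighbours : ∀ {u x} → H (ι₁ u) x → x ≡ ι₁ (next u) ⊎ x ≡ ι₁ (prev u) ⊎ x ≡ ι₂ (f u)
  ι₁-neighbours {u} {x} u~x with ι-cases x
  ... | inj₁ (v , refl) with adj⇒next⊎prev (subst id (H-ι₁ι₁ u v) u~x)
  ...   | inj₁ v≡next = inj₁ (cong ι₁ v≡next)
  ...   | inj₂ v≡prev = inj₂ (inj₁ (cong ι₁ v≡prev))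
  ι₁-neighbours {u} {x} u~x | inj₂ (w , refl) = inj₂ (inj₂ (cong ι₂ (subst id (H-ι₁ι₂ u w) u~x)))

  ι₂-neighbours : ∀ {w x} → H (ι₂ w) x →
                  x ≡ ι₂ (next w) ⊎ x ≡ ι₂ (prev w) ⊎ ∃[ u ] (f u ≡ w × x ≡ ι₁ u)
  ι₂-neighbours {w} {x} w~x with ι-cases x
  ... | inj₂ (v , refl) with adj⇒next⊎prev (subst id (H-ι₂ι₂ w v) w~x)
  ...   | inj₁ v≡next = inj₁ (cong ι₂ v≡next)
  ...   | inj₂ v≡prev = inj₂ (inj₁ (cong ι₂ v≡prev))
  ι₂-neighbours {w} {x} w~x | inj₁ (u , refl) = inj₂ (inj₂ (u , sym (subst id (H-ι₂ι₁ u w) w~x) , refl))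

  R : Subset n
  R = range f

  AvoidsRange : (ℕ → Fin n) → ℕ → Set
  AvoidsRange walk r = ∀ {i} → i ≤ r → walk i ∉ R

  first-in-range : (walk : ℕ → Fin n) → walk 0 ∉ R → (∀ w → ∃[ j ] walk j ≡ w) →
                   ∃[ r ] (walk (suc r) ∈ R × AvoidsRange walk r)
  first-in-range walk start∉R onto with onto (f zero)
  ... | zero , eq = contradiction (∈-range⁺ f zero (sym eq)) start∉R
  ... | suc m , eq
    with least-witness (λ i → walk (suc i) ∈ R) (λ i → walk (suc i) ∈? R) {m} (∈-range⁺ f zero (sym eq))
  ...   | r , end∈R , before = r , end∈R , off-range
    where
    off-range : AvoidsRange walk r
    off-range {zero} _ = start∉R
    off-range {suc i} i<r = before i<r

  ι₁-three-neighbours : ∀ u → ThreeNeighbours H (ι₁ u)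
  ι₁-three-neighbours u = record
    { u~x = ι₁-next u ; u~y = ι₁-prev u ; u~z = ι₁-f u
    ; u≢x = next≢id u ∘ sym ∘ ι₁-injective ; u≢y = prev≢id u ∘ sym ∘ ι₁-injective ; u≢z = ι₁≢ι₂
    ; x≢y = prev≢next u ∘ sym ∘ ι₁-injective ; x≢z = ι₁≢ι₂ ; y≢z = ι₁≢ι₂ }

  ι₂-three-neighbours : ∀ {w} → w ∈ R → ThreeNeighbours H (ι₂ w)
  ι₂-three-neighbours {w} w∈R with ∈-range⁻ f w∈R
  ... | p , fp≡w = record
    { z = ι₁ p ; u~x = ι₂-next w ; u~y = ι₂-prev w ; u~z = ι₂-f⁻¹ fp≡w
    ; u≢x = next≢id w ∘ sym ∘ ι₂-injective ; u≢y = prev≢id w ∘ sym ∘ ι₂-injective ; u≢z = ι₁≢ι₂ ∘ sym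
    ; x≢y = prev≢next w ∘ sym ∘ ι₂-injective ; x≢z = ι₁≢ι₂ ∘ sym ; y≢z = ι₁≢ι₂ ∘ sym }

  module Forcing (S : Subset (n + n)) where

    B : Fin (n + n) → Set
    B = Black H S

    force-ι₁-next : ∀ {u} → B (ι₁ u) → B (ι₁ (prev u)) → B (ι₂ (f u)) → B (ι₁ (next u))
    force-ι₁-next {u} black-u black-prev black-fu = force black-u (ι₁-next u) others
      where
      others : ∀ x → H (ι₁ u) x → x ≢ ι₁ (next u) → B x
      others x u~x x≢next with ι₁-neighbours {u} u~x
      ... | inj₁ x≡next = contradiction x≡next x≢next
      ... | inj₂ (inj₁ refl) = black-prev
      ... | inj₂ (inj₂ refl) = black-fu

    force-ι₂-f : ∀ {u} → B (ι₁ u) → B (ι₁ (next u)) → B (ι₁ (prev u)) → B (ι₂ (f u))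
    force-ι₂-f {u} black-u black-next black-prev = force black-u (ι₁-f u) others
      where
      others : ∀ x → H (ι₁ u) x → x ≢ ι₂ (f u) → B x
      others x u~x x≢fu with ι₁-neighbours {u} {x} u~x
      ... | inj₁ refl = black-next
      ... | inj₂ (inj₁ refl) = black-prev
      ... | inj₂ (inj₂ x≡fu) = contradiction x≡fu x≢fu

    force-ι₂-next : ∀ {w} → (∀ {u} → f u ≡ w → B (ι₁ u)) → B (ι₂ w) → B (ι₂ (prev w)) →
                    B (ι₂ (next w))
    force-ι₂-next {w} black-fibre black-w black-prev = force black-w (ι₂-next w) others
      where
      others : ∀ x → H (ι₂ w) x → x ≢ ι₂ (next w) → B x
      others x w~x x≢next with ι₂-neighbours {w} {x} w~x
      ... | inj₁ x≡next = contradiction x≡next x≢next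
      ... | inj₂ (inj₁ refl) = black-prev
      ... | inj₂ (inj₂ (u , fu≡w , refl)) = black-fibre fu≡w

module UpperBound (k : ℕ) (f : Fin (3 + k) → Fin (3 + k)) where

  open CycleFunctigraph k f

  ∃-range-exit : ∣ R ∣ < n → ∃[ c ] (c ∉ R × prev c ∈ R)
  ∃-range-exit ∣R∣<n with ∣p∣<n⇒∃∉ R ∣R∣<n
  ... | c₀ , c₀∉R with next^-surjective (f zero) c₀
  ... | m , eq
    with least-witness (λ i → next^ i (f zero) ∉ R) (λ i → ¬? (next^ i (f zero) ∈? R)) {m}
                       (subst (_∉ R) (sym eq) c₀∉R)
  ...   | zero , f0∉R , _ = contradiction (∈-range⁺ f zero refl) f0∉R
  ...   | suc j , c∉R , before =
          next^ (suc j) (f zero) , c∉R ,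
          subst (_∈ R) (sym (prev-next _)) (decidable-stable (_ ∈? R) (before ≤-refl))

  wrap⇒∣R∣≤1 : ∀ {c r} → AvoidsRange (λ i → next^ i c) r → prev c ≡ next^ (suc r) c → ∣ R ∣ ≤ 1
  wrap⇒∣R∣≤1 {c} {r} off-range prev≡b = ⊆⁅x⁆⇒∣p∣≤1 only-b
    where
    period : next (next^ (suc r) c) ≡ c
    period = trans (cong next (sym prev≡b)) (next-prev c)
    only-b : ∀ {w} → w ∈ R → w ≡ next^ (suc r) c
    only-b {w} w∈R with next^-period⇒covered {l = suc r} period w
    ... | i , i≤r+1 , refl with m≤n⇒m<n∨m≡n i≤r+1
    ...   | inj₁ (s≤s i≤r) = contradiction w∈R (off-range i≤r)
    ...   | inj₂ refl = refl

  module Seed {c r} (off-range : AvoidsRange (λ i → next^ i c) r) (prev-c∈R : prev c ∈ R)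
              (b∈R : next^ (suc r) c ∈ R) (prev-c≢b : prev c ≢ next^ (suc r) c) where

    b : Fin n
    b = next^ (suc r) c

    seed₁ seed₂ : Subset n
    seed₁ = inside ∷ inside ∷ ∅
    seed₂ = (R - b) ∪ ⁅ c ⁆

    seed : Subset (n + n)
    seed = seed₁ ++ seed₂

    ∣seed∣≤∣R∣+2 : ∣ seed ∣ ≤ ∣ R ∣ + 2
    ∣seed∣≤∣R∣+2 = begin
      ∣ seed ∣                               ≡⟨ ∣p++q∣≡∣p∣+∣q∣ seed₁ seed₂ ⟩
      2 + ∣ ∅ {n = suc k} ∣ + ∣ seed₂ ∣       ≡⟨ cong (λ z → 2 + z + ∣ seed₂ ∣) (∣⊥∣≡0 (suc k)) ⟩
      2 + ∣ seed₂ ∣                          ≤⟨ +-monoʳ-≤ 2 (∣p∪q∣≤∣p∣+∣q∣ (R - b) ⁅ c ⁆) ⟩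
      2 + (∣ R - b ∣ + ∣ ⁅ c ⁆ ∣)             ≡⟨ cong (λ z → 2 + (∣ R - b ∣ + z)) (∣⁅x⁆∣≡1 c) ⟩
      2 + (∣ R - b ∣ + 1)                    ≡⟨ cong (2 +_) (+-comm ∣ R - b ∣ 1) ⟩
      2 + suc ∣ R - b ∣                      ≤⟨ +-monoʳ-≤ 2 (x∈p⇒∣p-x∣<∣p∣ b∈R) ⟩
      2 + ∣ R ∣                              ≡⟨ +-comm 2 ∣ R ∣ ⟩
      ∣ R ∣ + 2                              ∎
      where open ≤-Reasoning

    open Forcing seed

    black-c : B (ι₂ c)
    black-c = initial (x∈q⇒a↑ʳx∈p++q {p = seed₁} (q⊆p∪q (R - b) ⁅ c ⁆ (x∈⁅x⁆ c)))

    black-R-b : ∀ {w} → w ∈ R → w ≢ b → B (ι₂ w)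
    black-R-b w∈R w≢b =
      initial (x∈q⇒a↑ʳx∈p++q {p = seed₁} (p⊆p∪q ⁅ c ⁆ (x∈p∧x∉q⇒x∈p─q w∈R (w≢b ∘ x∈⁅y⁆⇒x≡y _))))

    black-run : ∀ i → i ≤ suc r → B (ι₂ (prev (next^ i c))) × B (ι₂ (next^ i c))
    black-run zero _ = black-R-b prev-c∈R prev-c≢b , black-c
    black-run (suc i) (s≤s i≤r) with black-run i (m≤n⇒m≤1+n i≤r)
    ... | black-prev , black-i =
          subst (B ∘ ι₂) (sym (prev-next _)) black-i ,
          force-ι₂-next (λ fu≡ → contradiction (∈-range⁺ f _ fu≡) (off-range i≤r)) black-i black-prev

    black-range : ∀ {w} → w ∈ R → B (ι₂ w)
    black-range {w} w∈R with w ≟ b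
    ... | yes refl = proj₂ (black-run (suc r) ≤-refl)
    ... | no w≢b = black-R-b w∈R w≢b

    black-G₁ : ∀ u → B (ι₁ u)
    black-G₁ = next-closed₂⇒all {c = suc zero}
      (initial (x∈p⇒x↑ˡ∈p++q {q = seed₂} here)) (initial (x∈p⇒x↑ˡ∈p++q {q = seed₂} (there here)))
      λ black-prev black-x → force-ι₁-next black-x black-prev (black-range (∈-range⁺ f _ refl))

    black-G₂ : ∀ w → B (ι₂ w)
    black-G₂ = next-closed₂⇒all (black-R-b prev-c∈R prev-c≢b) black-c
      λ black-prev black-x → force-ι₂-next (λ _ → black-G₁ _) black-x black-prev

    seed-zeroForcing : IsZeroForcingSet H seed
    seed-zeroForcing x with ι-cases x
    ... | inj₁ (u , refl) = black-G₁ u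
    ... | inj₂ (w , refl) = black-G₂ w

  upper-bound : 1 < ∣ R ∣ → ∣ R ∣ < n → H Z≤ (∣ R ∣ + 2)
  upper-bound 1<∣R∣ ∣R∣<n with ∃-range-exit ∣R∣<n
  ... | c , c∉R , prev-c∈R with first-in-range (λ i → next^ i c) c∉R (next^-surjective c)
  ... | r , b∈R , off-range = seed , seed-zeroForcing , ∣seed∣≤∣R∣+2
    where open Seed off-range prev-c∈R b∈R (λ prev≡b → <⇒≱ 1<∣R∣ (wrap⇒∣R∣≤1 off-range prev≡b))

module LowerBound (k : ℕ) (f : Fin (3 + k) → Fin (3 + k)) where

  open CycleFunctigraph k f

  UniquePreimage : Fin n → Set
  UniquePreimage q = ∀ q′ → f q′ ≡ f q → q′ ≡ q

  uniquePreimage? : ∀ q → Dec (UniquePreimage q)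
  uniquePreimage? q = all? λ q′ → f q′ ≟ f q →-dec q′ ≟ q

  ¬unique⇒sibling : ∀ {q} → ¬ UniquePreimage q → ∃[ q′ ] (f q′ ≡ f q × q′ ≢ q)
  ¬unique⇒sibling {q} ¬unique with ¬∀⟶∃¬ n _ (λ q′ → f q′ ≟ f q →-dec q′ ≟ q) ¬unique
  ... | q′ , ¬implies with f q′ ≟ f q
  ...   | yes same = q′ , same , λ q′≡q → ¬implies (λ _ → q′≡q)
  ...   | no differ = contradiction (λ same → contradiction same differ) ¬implies

  module TwoValuedRange {v₁ v₂} (R⊆v₁v₂ : ∀ {w} → w ∈ R → w ≡ v₁ ⊎ w ≡ v₂) where

    unique⇒¬unique-next : ∀ {q} → UniquePreimage q → ¬ UniquePreimage (next q)
    unique⇒¬unique-next {q} unique-q unique-next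
      with two-valued (R⊆v₁v₂ (∈-range⁺ f q refl)) (R⊆v₁v₂ (∈-range⁺ f (next q) refl))
                      (R⊆v₁v₂ (∈-range⁺ f (next (next q)) refl))
                      (λ same → next≢id q (unique-q (next q) (sym same)))
    ... | inj₁ same = next²≢id q (unique-q _ same)
    ... | inj₂ same = next≢id (next q) (unique-next _ same)

    unique⇒¬unique-prev : ∀ {q} → UniquePreimage q → ¬ UniquePreimage (prev q)
    unique⇒¬unique-prev {q} unique-q unique-prev =
      unique⇒¬unique-next unique-prev (subst UniquePreimage (sym (next-prev q)) unique-q)

    G₂∪Unique : Fin (n + n) → Set
    G₂∪Unique x = (∃[ w ] x ≡ ι₂ w) ⊎ (∃[ q ] (x ≡ ι₁ q × UniquePreimage q))

    unique-of : ∀ {q} → G₂∪Unique (ι₁ q) → UniquePreimage q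
    unique-of (inj₁ (_ , ι₁≡ι₂)) = ⊥-elim (ι₁≢ι₂ ι₁≡ι₂)
    unique-of (inj₂ (_ , eq , unique)) = subst UniquePreimage (sym (ι₁-injective eq)) unique

    G₂∪Unique? : ∀ x → Dec (G₂∪Unique x)
    G₂∪Unique? x with ι-cases x
    ... | inj₂ (w , refl) = yes (inj₁ (w , refl))
    ... | inj₁ (q , refl) with uniquePreimage? q
    ...   | yes unique = yes (inj₂ (q , refl , unique))
    ...   | no ¬unique = no (¬unique ∘ unique-of)

    G₂∪Unique-closed : ForcingClosed H G₂∪Unique
    G₂∪Unique-closed {v = x} (inj₁ (w , refl)) w~x x∉P with ι₂-neighbours {w} {x} w~x
    ... | inj₁ refl = ⊥-elim (x∉P (inj₁ (_ , refl)))
    ... | inj₂ (inj₁ refl) = ⊥-elim (x∉P (inj₁ (_ , refl)))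
    ... | inj₂ (inj₂ (p , fp≡w , refl)) with ¬unique⇒sibling (λ unique → x∉P (inj₂ (p , refl , unique)))
    ...   | p′ , fp′≡fp , p′≢p =
            ι₁ p′ , ι₂-f⁻¹ (trans fp′≡fp fp≡w) , p′≢p ∘ ι₁-injective ,
            λ P-p′ → p′≢p (sym (unique-of P-p′ p (sym fp′≡fp)))
    G₂∪Unique-closed {v = x} (inj₂ (q , refl , unique)) q~x x∉P with ι₁-neighbours {q} {x} q~x
    ... | inj₁ refl =
          ι₁ (prev q) , ι₁-prev q , prev≢next q ∘ ι₁-injective , unique⇒¬unique-prev unique ∘ unique-of
    ... | inj₂ (inj₁ refl) =
          ι₁ (next q) , ι₁-next q , prev≢next q ∘ sym ∘ ι₁-injective , unique⇒¬unique-next unique ∘ unique-of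
    ... | inj₂ (inj₂ refl) = ⊥-elim (x∉P (inj₁ (_ , refl)))

    ∃∉G₂∪Unique : ∃[ x ] ¬ G₂∪Unique x
    ∃∉G₂∪Unique with uniquePreimage? zero
    ... | yes unique = ι₁ (next zero) , unique⇒¬unique-next unique ∘ unique-of
    ... | no ¬unique = ι₁ zero , ¬unique ∘ unique-of

  module Arc {c r l} (b∈R : next^ (suc r) c ∈ R) (off-range-forward : AvoidsRange (λ i → next^ i c) r)
                     (a∈R : prev^ (suc l) c ∈ R) (off-range-backward : AvoidsRange (λ i → prev^ i c) l) where

    b a : Fin n
    b = next^ (suc r) c
    a = prev^ (suc l) c

    InArc : Fin n → Set
    InArc w = (∃[ i ] (i < 2 + r × next^ i c ≡ w)) ⊎ (∃[ i ] (i < 2 + l × prev^ i c ≡ w))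

    inArc? : ∀ w → Dec (InArc w)
    inArc? w = anyUpTo? (λ i → next^ i c ≟ w) (2 + r) ⊎-dec anyUpTo? (λ i → prev^ i c ≟ w) (2 + l)

    c∈arc : InArc c
    c∈arc = inj₁ (0 , s≤s z≤n , refl)

    next-c∈arc : InArc (next c)
    next-c∈arc = inj₁ (1 , s≤s (s≤s z≤n) , refl)

    prev-c∈arc : InArc (prev c)
    prev-c∈arc = inj₂ (1 , s≤s (s≤s z≤n) , refl)

    prev-b∈arc : InArc (prev b)
    prev-b∈arc = inj₁ (r , ≤-trans (n<1+n r) (n≤1+n _) , sym (prev-next _))

    next-a∈arc : InArc (next a)
    next-a∈arc = inj₂ (l , ≤-trans (n<1+n l) (n≤1+n _) , sym (next-prev _))

    arc∩R : ∀ {w} → InArc w → w ∈ R → w ≡ b ⊎ w ≡ a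
    arc∩R (inj₁ (i , s≤s i≤r+1 , refl)) w∈R with m≤n⇒m<n∨m≡n i≤r+1
    ... | inj₁ (s≤s i≤r) = contradiction w∈R (off-range-forward i≤r)
    ... | inj₂ refl = inj₁ refl
    arc∩R (inj₂ (i , s≤s i≤l+1 , refl)) w∈R with m≤n⇒m<n∨m≡n i≤l+1
    ... | inj₁ (s≤s i≤l) = contradiction w∈R (off-range-backward i≤l)
    ... | inj₂ refl = inj₂ refl

    arc-next : ∀ {w} → InArc w → w ∉ R → InArc (next w)
    arc-next (inj₁ (i , s≤s i≤r+1 , refl)) w∉R with m≤n⇒m<n∨m≡n i≤r+1
    ... | inj₁ i<r+1 = inj₁ (suc i , s≤s i<r+1 , refl)
    ... | inj₂ refl = contradiction b∈R w∉R
    arc-next (inj₂ (zero , _ , refl)) _ = next-c∈arc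
    arc-next (inj₂ (suc i , i+1<l+2 , refl)) _ = inj₂ (i , ≤-trans (n≤1+n _) i+1<l+2 , sym (next-prev _))

    arc-prev : ∀ {w} → InArc w → w ∉ R → InArc (prev w)
    arc-prev (inj₂ (i , s≤s i≤l+1 , refl)) w∉R with m≤n⇒m<n∨m≡n i≤l+1
    ... | inj₁ i<l+1 = inj₂ (suc i , s≤s i<l+1 , refl)
    ... | inj₂ refl = contradiction a∈R w∉R
    arc-prev (inj₁ (zero , _ , refl)) _ = prev-c∈arc
    arc-prev (inj₁ (suc i , i+1<r+2 , refl)) _ = inj₁ (i , ≤-trans (n≤1+n _) i+1<r+2 , sym (prev-next _))

    wrapping⇒all-in-arc : InArc (next b) ⊎ InArc (prev a) → ∀ w → InArc w
    wrapping⇒all-in-arc (inj₁ next-b∈arc) = next-closed⇒all c∈arc step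
      where
      step : ∀ {x} → InArc x → InArc (next x)
      step {x} x∈arc with x ∈? R
      ... | no x∉R = arc-next x∈arc x∉R
      ... | yes x∈R with arc∩R x∈arc x∈R
      ...   | inj₁ refl = next-b∈arc
      ...   | inj₂ refl = next-a∈arc
    wrapping⇒all-in-arc (inj₂ prev-a∈arc) = prev-closed⇒all c∈arc step
      where
      step : ∀ {x} → InArc x → InArc (prev x)
      step {x} x∈arc with x ∈? R
      ... | no x∉R = arc-prev x∈arc x∉R
      ... | yes x∈R with arc∩R x∈arc x∈R
      ...   | inj₁ refl = prev-b∈arc
      ...   | inj₂ refl = prev-a∈arc

    G₂Arc : Fin (n + n) → Set
    G₂Arc x = ∃[ w ] (x ≡ ι₂ w × InArc w)

    ι₁∉G₂Arc : ∀ {u} → ¬ G₂Arc (ι₁ u)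
    ι₁∉G₂Arc (_ , ι₁≡ι₂ , _) = ι₁≢ι₂ ι₁≡ι₂

    in-arc-of : ∀ {w} → G₂Arc (ι₂ w) → InArc w
    in-arc-of (_ , eq , w∈arc) = subst InArc (sym (ι₂-injective eq)) w∈arc

    G₂Arc? : ∀ x → Dec (G₂Arc x)
    G₂Arc? x with ι-cases x
    ... | inj₁ (u , refl) = no ι₁∉G₂Arc
    ... | inj₂ (w , refl) with inArc? w
    ...   | yes w∈arc = yes (w , refl , w∈arc)
    ...   | no w∉arc = no (w∉arc ∘ in-arc-of)

    G₂Arc-closed : ¬ InArc (next b) → ¬ InArc (prev a) → ForcingClosed H G₂Arc
    G₂Arc-closed _ _ {v = x} (w , refl , w∈arc) w~x x∉P with w ∈? R
    ... | no w∉R with ι₂-neighbours {w} {x} w~x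
    ...   | inj₁ refl = ⊥-elim (x∉P (_ , refl , arc-next w∈arc w∉R))
    ...   | inj₂ (inj₁ refl) = ⊥-elim (x∉P (_ , refl , arc-prev w∈arc w∉R))
    ...   | inj₂ (inj₂ (p , fp≡w , _)) = contradiction (∈-range⁺ f p fp≡w) w∉R
    G₂Arc-closed next-b∉arc prev-a∉arc {v = x} (w , refl , w∈arc) w~x x∉P | yes w∈R
      with ∈-range⁻ f w∈R | arc∩R w∈arc w∈R | ι₂-neighbours {w} {x} w~x
    ... | _ | inj₁ refl | inj₂ (inj₂ (_ , _ , refl)) =
          ι₂ (next w) , ι₂-next w , ι₁≢ι₂ ∘ sym , next-b∉arc ∘ in-arc-of
    ... | _ | inj₂ refl | inj₂ (inj₂ (_ , _ , refl)) =
          ι₂ (prev w) , ι₂-prev w , ι₁≢ι₂ ∘ sym , prev-a∉arc ∘ in-arc-of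
    ... | p , fp≡w | inj₁ refl | inj₁ refl = ι₁ p , ι₂-f⁻¹ fp≡w , ι₁≢ι₂ , ι₁∉G₂Arc
    ... | p , fp≡w | inj₁ refl | inj₂ (inj₁ refl) = ⊥-elim (x∉P (_ , refl , prev-b∈arc))
    ... | p , fp≡w | inj₂ refl | inj₁ refl = ⊥-elim (x∉P (_ , refl , next-a∈arc))
    ... | p , fp≡w | inj₂ refl | inj₂ (inj₁ refl) = ι₁ p , ι₂-f⁻¹ fp≡w , ι₁≢ι₂ , ι₁∉G₂Arc

  module _ {S : Subset (n + n)} (∣S∣≤2 : ∣ S ∣ ≤ 2) where

    StartsForcing : Fin n → Set
    StartsForcing c = c ∉ R × ι₂ c ∈ S × (ι₂ (next c) ∈ S ⊎ ι₂ (prev c) ∈ S)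

    startsForcing? : ∀ c → Dec (StartsForcing c)
    startsForcing? c = ¬? (c ∈? R) ×-dec ι₂ c ∈? S ×-dec (ι₂ (next c) ∈? S ⊎-dec ι₂ (prev c) ∈? S)

    no-start⇒S-closed : (∀ c → ¬ StartsForcing c) → ForcingClosed H (_∈ S)
    no-start⇒S-closed no-start {u} {x} u∈S u~x x∉S with ι-cases u
    ... | inj₁ (q , refl) = three-neighbours⇒white-neighbour ∣S∣≤2 u∈S (ι₁-three-neighbours q) x
    ... | inj₂ (w , refl) with w ∈? R
    ...   | yes w∈R = three-neighbours⇒white-neighbour ∣S∣≤2 u∈S (ι₂-three-neighbours w∈R) x
    ...   | no w∉R with ι₂-neighbours {w} {x} u~x
    ...     | inj₁ refl = ι₂ (prev w) , ι₂-prev w , prev≢next w ∘ ι₂-injective ,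
                          λ prev∈S → no-start w (w∉R , u∈S , inj₂ prev∈S)
    ...     | inj₂ (inj₁ refl) = ι₂ (next w) , ι₂-next w , prev≢next w ∘ sym ∘ ι₂-injective ,
                                 λ next∈S → no-start w (w∉R , u∈S , inj₁ next∈S)
    ...     | inj₂ (inj₂ (p , fp≡w , _)) = contradiction (∈-range⁺ f p fp≡w) w∉R

    module DegreeTwoStart {c d r l} (c∈S : ι₂ c ∈ S) (d∈S : ι₂ d ∈ S) (c~d : d ≡ next c ⊎ d ≡ prev c)
      (b∈R : next^ (suc r) c ∈ R) (off-range-forward : AvoidsRange (λ i → next^ i c) r)
      (a∈R : prev^ (suc l) c ∈ R) (off-range-backward : AvoidsRange (λ i → prev^ i c) l) where

      open Arc b∈R off-range-forward a∈R off-range-backward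

      S⊆cd : ∀ {x} → x ∈ S → x ≡ ι₂ c ⊎ x ≡ ι₂ d
      S⊆cd {x} x∈S with x ≟ ι₂ c | x ≟ ι₂ d
      ... | yes x≡c | _ = inj₁ x≡c
      ... | no _ | yes x≡d = inj₂ x≡d
      ... | no x≢c | no x≢d = ⊥-elim (∣p∣≤2⇒¬x,y,z∈p ∣S∣≤2 c∈S d∈S x∈S c≢d (x≢c ∘ sym) (x≢d ∘ sym))
        where
        c≢d : ι₂ c ≢ ι₂ d
        c≢d ι₂c≡ι₂d = [ (λ d≡next → next≢id c (trans (sym d≡next) (sym c≡d))) ,
                        (λ d≡prev → prev≢id c (trans (sym d≡prev) (sym c≡d))) ]′ c~d
          where c≡d = ι₂-injective ι₂c≡ι₂d

      d∈arc : InArc d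
      d∈arc = [ (λ d≡next → subst InArc (sym d≡next) next-c∈arc) ,
                (λ d≡prev → subst InArc (sym d≡prev) prev-c∈arc) ]′ c~d

      S⊆G₂Arc : ∀ {x} → x ∈ S → G₂Arc x
      S⊆G₂Arc x∈S with S⊆cd x∈S
      ... | inj₁ x≡c = c , x≡c , c∈arc
      ... | inj₂ x≡d = d , x≡d , d∈arc

      wrapping⇒¬zeroForcing : InArc (next b) ⊎ InArc (prev a) → ¬ IsZeroForcingSet H S
      wrapping⇒¬zeroForcing wraps =
        closed⇒¬zeroForcing H G₂∪Unique? (λ x∈S → inj₁ (_ , proj₁ (proj₂ (S⊆G₂Arc x∈S))))
          G₂∪Unique-closed (proj₂ ∃∉G₂∪Unique)
        where open TwoValuedRange (arc∩R (wrapping⇒all-in-arc wraps _))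

      not-zero-forcing : ¬ IsZeroForcingSet H S
      not-zero-forcing with inArc? (next b) | inArc? (prev a)
      ... | yes next-b∈arc | _ = wrapping⇒¬zeroForcing (inj₁ next-b∈arc)
      ... | no _ | yes prev-a∈arc = wrapping⇒¬zeroForcing (inj₂ prev-a∈arc)
      ... | no next-b∉arc | no prev-a∉arc =
            closed⇒¬zeroForcing H G₂Arc? S⊆G₂Arc (G₂Arc-closed next-b∉arc prev-a∉arc)
              (ι₁∉G₂Arc {zero})

    degree-two-start⇒¬zeroForcing : ∀ {c d} → c ∉ R → ι₂ c ∈ S → ι₂ d ∈ S → d ≡ next c ⊎ d ≡ prev c →
                                    ¬ IsZeroForcingSet H S
    degree-two-start⇒¬zeroForcing {c} c∉R c∈S d∈S c~d
      with first-in-range (λ i → next^ i c) c∉R (next^-surjective c)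
         | first-in-range (λ i → prev^ i c) c∉R (prev^-surjective c)
    ... | _ , b∈R , off-range-forward | _ , a∈R , off-range-backward =
          DegreeTwoStart.not-zero-forcing c∈S d∈S c~d b∈R off-range-forward a∈R off-range-backward

    not-zero-forcing : ¬ IsZeroForcingSet H S
    not-zero-forcing with any? startsForcing?
    ... | no none = closed⇒¬zeroForcing H (_∈? S) id (no-start⇒S-closed λ c start → none (c , start))
                      (proj₂ (∣p∣<n⇒∃∉ S (≤-trans (s≤s ∣S∣≤2) (s≤s (s≤s (s≤s z≤n))))))
    ... | yes (c , c∉R , c∈S , inj₁ next∈S) = degree-two-start⇒¬zeroForcing c∉R c∈S next∈S (inj₁ refl)
    ... | yes (c , c∉R , c∈S , inj₂ prev∈S) = degree-two-start⇒¬zeroForcing c∉R c∈S prev∈S (inj₂ refl)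

  lower-bound : 3 ≤Z H
  lower-bound S zfs with 3 ≤? ∣ S ∣
  ... | yes 3≤∣S∣ = 3≤∣S∣
  ... | no 3≰∣S∣ = ⊥-elim (not-zero-forcing (≤-pred (≰⇒> 3≰∣S∣)) zfs)

f₃ : Fin 3 → Fin 3
f₃ zero = zero
f₃ (suc zero) = zero
f₃ (suc (suc zero)) = suc zero

module Functigraph₃ where

  open CycleFunctigraph 0 f₃

  G₁ : Subset (n + n)
  G₁ = ⊤ {n} ++ ∅ {n}

  open Forcing G₁

  black-ι₁ : ∀ u → B (ι₁ u)
  black-ι₁ u = initial (x∈p⇒x↑ˡ∈p++q {q = ∅} ∈⊤)

  black-ι₂-f : ∀ u → B (ι₂ (f₃ u))
  black-ι₂-f u = force-ι₂-f {u} (black-ι₁ u) (black-ι₁ (next u)) (black-ι₁ (prev u))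

  G₁-zeroForcing : IsZeroForcingSet H G₁
  G₁-zeroForcing x with ι-cases x
  ... | inj₁ (u , refl) = black-ι₁ u
  ... | inj₂ (zero , refl) = black-ι₂-f zero
  ... | inj₂ (suc zero , refl) = black-ι₂-f (suc (suc zero))
  ... | inj₂ (suc (suc zero) , refl) =
        force-ι₂-next {suc zero} (λ _ → black-ι₁ _) (black-ι₂-f (suc (suc zero))) (black-ι₂-f zero)

  Z≤3 : H Z≤ 3
  Z≤3 = G₁ , G₁-zeroForcing , ≤-refl

cycleAdj? : ∀ n i j → Dec (CycleAdj n i j)
cycleAdj? n i j = (toℕ i + 1 ℕ.≟ toℕ j) ⊎-dec (toℕ j + 1 ℕ.≟ toℕ i)
  ⊎-dec ((toℕ i + 1 ℕ.≟ n) ×-dec (toℕ j ℕ.≟ 0)) ⊎-dec ((toℕ j + 1 ℕ.≟ n) ×-dec (toℕ i ℕ.≟ 0))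

functigraph? : ∀ {n} {G : Graph n} → (∀ u v → Dec (G u v)) → (f : Fin n → Fin n) →
               ∀ x y → Dec (Functigraph G f x y)
functigraph? {n} G? f x y with splitAt n x | splitAt n y
... | inj₁ u | inj₁ v = G? u v
... | inj₂ u | inj₂ v = G? u v
... | inj₁ u | inj₂ v = v ≟ f u
... | inj₂ v | inj₁ u = v ≟ f u

f₄ : Fin 4 → Fin 4
f₄ zero = zero
f₄ (suc zero) = zero
f₄ (suc (suc zero)) = zero
f₄ (suc (suc (suc zero))) = suc (suc zero)

-- By exhaustive search over the 2⁸ vertex subsets.
4≤Z₄ : 4 ≤Z Functigraph (CycleAdj 4) f₄
4≤Z₄ = Search.≤Z-by-search (functigraph? (cycleAdj? 4) f₄) 4 _

zeroForcing-bounds : (n : ℕ) → 3 ≤ n → (f : Fin n → Fin n) → 1 < ∣ range f ∣ → ∣ range f ∣ < n →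
                     (3 ≤Z Functigraph (CycleAdj n) f) × (Functigraph (CycleAdj n) f Z≤ (∣ range f ∣ + 2))
zeroForcing-bounds (suc (suc (suc k))) (s≤s (s≤s (s≤s z≤n))) f 1<s s<n =
  LowerBound.lower-bound k f , UpperBound.upper-bound k f 1<s s<n

theorem5p8 :
    ((n : ℕ) → 3 ≤ n → (f : Fin n → Fin n) → 1 < ∣ range f ∣ → ∣ range f ∣ < n →
      (3 ≤Z Functigraph (CycleAdj n) f) × (Functigraph (CycleAdj n) f Z≤ (∣ range f ∣ + 2)))
    × (∃[ n ] ∃[ f ] (3 ≤ n × 1 < ∣ range {n} f ∣ × ∣ range f ∣ < n
        × (Functigraph (CycleAdj n) f Z≡ 3)))
    × (∃[ n ] ∃[ f ] (3 ≤ n × 1 < ∣ range {n} f ∣ × ∣ range f ∣ < n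
        × (Functigraph (CycleAdj n) f Z≡ (∣ range f ∣ + 2))))
theorem5p8 =
  zeroForcing-bounds ,
  (3 , f₃ , ≤-refl , ≤-refl , ≤-refl , LowerBound.lower-bound 0 f₃ , Functigraph₃.Z≤3) ,
  (4 , f₄ , 3≤4 , ≤-refl , 3≤4 , 4≤Z₄ , UpperBound.upper-bound 1 f₄ ≤-refl 3≤4)
  where
  3≤4 : 3 ≤ 4
  3≤4 = s≤s (s≤s (s≤s z≤n))
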